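{- Let $D$ be a digraph whose underlying graph has girth at least $7$. If $K$ is a clique in the open in-neighborhood graph ${\mathcal N}^-_o(D)$, then there is a vertex $w$ of $D$ such that $K\subseteq N^+_D(w)$.
   Context: All digraphs are finite, and their arc relation is irreflexive. $N^+_D(v)$ denotes the set of out-neighbors and $N^-_D(v)$ the set of in-neighbors of $v$. The underlying graph of $D$ is the undirected graph on $V(D)$ where $u,v$ are adjacent iff $uv$ or $vu$ is an arc; girth at least 7 means it has no cycle of length less than 7 (acyclic allowed). The open in-neighborhood graph ${\mathcal N}^-_o(D)$ is the undirected graph on $V(D)$ in which distinct $u,v$ are adjacent iff $N^-_D(u)\cap N^-_D(v)\neq\emptyset$. -}

module Defs where

open import Data.Nat using (ℕ; suc; _≤_)
open import Data.Fin using (Fin; zero; suc; fromℕ; inject₁)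
open import Data.Product using (Σ; ∃; _×_; _,_)
open import Data.Sum using (_⊎_)
open import Data.Empty using (⊥)
open import Relation.Nullary using (¬_)
open import Relation.Binary.PropositionalEquality using (_≡_; _≢_)
open import Function.Definitions using (Injective)
open import Level using (0ℓ)

record Digraph : Set₁ where
  field
    n     : ℕ
    Arc   : Fin n → Fin n → Set
    irrefl : ∀ v → ¬ Arc v v
open Digraph public

Vertex : Digraph → Set
Vertex D = Fin (n D)

-- N⁺_D(w) ∋ x  iff  Arc D w x  (used directly in the statement).

UAdj : (D : Digraph) → Vertex D → Vertex D → Set
UAdj D u v = Arc D u v ⊎ Arc D v u

record Cycle (D : Digraph) (k : ℕ) : Set where
  field
    m      : ℕ
    k≡     : k ≡ suc m
    len≥3  : 3 ≤ k
    c      : Fin (suc m) → Vertex D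
    inj    : Injective _≡_ _≡_ c
    adj    : ∀ (i : Fin m) → UAdj D (c (inject₁ i)) (c (suc i))
    close  : UAdj D (c (fromℕ m)) (c zero)

GirthAtLeast7 : Digraph → Set
GirthAtLeast7 D = ∀ k → k Data.Nat.< 7 → ¬ Cycle D k

NoAdj : (D : Digraph) → Vertex D → Vertex D → Set
NoAdj D u v = u ≢ v × ∃ λ w → Arc D w u × Arc D w v

IsCliqueNo : (D : Digraph) → (Vertex D → Set) → Set
IsCliqueNo D K = ∀ u v → K u → K v → u ≢ v → NoAdj D u v

{-# OPTIONS --safe #-}

-- Let u, v, x be distinct members of K, with common in-neighbours w of u and
-- v, a of v and x, and b of x and u.  If w, a, b were pairwise distinct, then
-- w v a x b u would be a 6-cycle: its vertices are distinct since any other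
-- coincidence closes a triangle.  Two distinct vertices cannot have two common
-- in-neighbours without a 4-cycle, so a = b forces a = w.  Hence w ∈ {a, b}
-- and w → x in every case.
module Submission where

open import Defs
open import Data.Product using (∃; _×_; _,_; proj₂)
open import Relation.Binary.PropositionalEquality using (_≡_; _≢_; refl; ≢-sym)
open import Data.Nat using (suc; _+_; _<?_; z≤n; s≤s)
open import Data.Fin using (Fin; zero; suc; inject₁; fromℕ; _≟_)
open import Data.Vec using (Vec; []; _∷_; lookup)
open import Data.Vec.Relation.Unary.All using ([]; _∷_)
open import Data.Vec.Relation.Unary.AllPairs using ([]; _∷_)
open import Data.Vec.Relation.Unary.Linked using (Linked; [-]; _∷_)
open import Data.Vec.Relation.Unary.Unique.Propositional using (Unique)
open import Data.Vec.Relation.Unary.Unique.Propositional.Properties using (lookup-injective)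
open import Data.Sum using (inj₁; inj₂)
open import Data.Empty using (⊥; ⊥-elim)
open import Relation.Binary.Core using (Rel)
open import Relation.Nullary using (¬_; yes; no)
open import Relation.Nullary.Decidable using (from-yes; decidable-stable)

Linked-lookup : ∀ {a ℓ} {A : Set a} {R : Rel A ℓ} {m} {xs : Vec A (suc m)} →
                Linked R xs → (i : Fin m) → R (lookup xs (inject₁ i)) (lookup xs (suc i))
Linked-lookup {xs = _ ∷ _ ∷ _} (r ∷ _)  zero    = r
Linked-lookup                  (_ ∷ rs) (suc i) = Linked-lookup rs i

CommonInNeighbour : (D : Digraph) → Vertex D → Vertex D → Vertex D → Set
CommonInNeighbour D w u v = Arc D w u × Arc D w v

module _ {D : Digraph} where

  distinctClosedWalk⇒Cycle : ∀ {m} (vs : Vec (Vertex D) (3 + m)) → Unique vs →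
                             Linked (UAdj D) vs → UAdj D (lookup vs (fromℕ (2 + m))) (lookup vs zero) →
                             Cycle D (3 + m)
  distinctClosedWalk⇒Cycle {m} vs distinct walk closing = record
    { m     = 2 + m
    ; k≡    = refl
    ; len≥3 = s≤s (s≤s (s≤s z≤n))
    ; c     = lookup vs
    ; inj   = λ {i} {j} → lookup-injective distinct i j
    ; adj   = Linked-lookup walk
    ; close = closing
    }

  Arc⇒≢ : ∀ {u v} → Arc D u v → u ≢ v
  Arc⇒≢ uv refl = irrefl D _ uv

  UAdj⇒≢ : ∀ {u v} → UAdj D u v → u ≢ v
  UAdj⇒≢ (inj₁ uv) = Arc⇒≢ uv
  UAdj⇒≢ (inj₂ vu) = ≢-sym (Arc⇒≢ vu)

  triangle⇒Cycle₃ : ∀ {p q r} → UAdj D p q → UAdj D q r → UAdj D r p → Cycle D 3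
  triangle⇒Cycle₃ {p} {q} {r} pq qr rp =
    distinctClosedWalk⇒Cycle (p ∷ q ∷ r ∷ [])
      ((UAdj⇒≢ pq ∷ ≢-sym (UAdj⇒≢ rp) ∷ []) ∷ (UAdj⇒≢ qr ∷ []) ∷ [] ∷ [])
      (pq ∷ qr ∷ [-]) rp

  commonInNeighbour-unique : ¬ Cycle D 4 → ∀ {u v w w′} → u ≢ v →
                             CommonInNeighbour D w u v → CommonInNeighbour D w′ u v → w ≡ w′
  commonInNeighbour-unique no4 {u} {v} {w} {w′} u≢v (wu , wv) (w′u , w′v) =
    decidable-stable (w ≟ w′) λ w≢w′ →
      no4 (distinctClosedWalk⇒Cycle (w ∷ u ∷ w′ ∷ v ∷ [])
             ( (Arc⇒≢ wu ∷ w≢w′ ∷ Arc⇒≢ wv ∷ [])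
             ∷ (≢-sym (Arc⇒≢ w′u) ∷ u≢v ∷ [])
             ∷ (Arc⇒≢ w′v ∷ [])
             ∷ [] ∷ [])
             (inj₁ wu ∷ inj₂ w′u ∷ inj₁ w′v ∷ [-]) (inj₂ wv))

  commonInNeighbour≢farVertex : ¬ Cycle D 3 → ∀ {u v x w a} →
                                CommonInNeighbour D w u v → CommonInNeighbour D a v x → w ≢ x
  commonInNeighbour≢farVertex no3 (_ , wv) (av , ax) refl =
    no3 (triangle⇒Cycle₃ (inj₁ ax) (inj₁ wv) (inj₂ av))

  commonInNeighbours-not-distinct :
    ¬ Cycle D 3 → ¬ Cycle D 6 → ∀ {u v x w a b} → u ≢ v → v ≢ x → x ≢ u →
    CommonInNeighbour D w u v → CommonInNeighbour D a v x → CommonInNeighbour D b x u →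
    w ≢ a → a ≢ b → b ≢ w → ⊥
  commonInNeighbours-not-distinct no3 no6 {u} {v} {x} {w} {a} {b}
    u≢v v≢x x≢u wuv@(wu , wv) avx@(av , ax) bxu@(bx , bu) w≢a a≢b b≢w =
    no6 (distinctClosedWalk⇒Cycle (w ∷ v ∷ a ∷ x ∷ b ∷ u ∷ [])
           ( (Arc⇒≢ wv ∷ w≢a ∷ far wuv avx ∷ ≢-sym b≢w ∷ Arc⇒≢ wu ∷ [])
           ∷ (≢-sym (Arc⇒≢ av) ∷ v≢x ∷ ≢-sym (far bxu wuv) ∷ ≢-sym u≢v ∷ [])
           ∷ (Arc⇒≢ ax ∷ a≢b ∷ far avx bxu ∷ [])
           ∷ (≢-sym (Arc⇒≢ bx) ∷ x≢u ∷ [])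
           ∷ (Arc⇒≢ bu ∷ [])
           ∷ [] ∷ [])
           (inj₁ wv ∷ inj₂ av ∷ inj₁ ax ∷ inj₂ bx ∷ inj₁ bu ∷ [-]) (inj₂ wu))
    where far = commonInNeighbour≢farVertex no3

  commonInNeighbour⇒inNeighbourOfThird :
    ¬ Cycle D 3 → ¬ Cycle D 4 → ¬ Cycle D 6 → ∀ {u v x w} → u ≢ v → v ≢ x → x ≢ u →
    CommonInNeighbour D w u v → ∃ (λ a → CommonInNeighbour D a v x) →
    ∃ (λ b → CommonInNeighbour D b x u) → Arc D w x
  commonInNeighbour⇒inNeighbourOfThird no3 no4 no6 {w = w} u≢v v≢x x≢u wuv
    (a , avx@(av , ax)) (b , bxu@(bx , bu))
    with w ≟ a | a ≟ b | b ≟ w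
  ... | yes refl | _        | _        = ax
  ... | _        | _        | yes refl = bx
  ... | _        | yes refl | _
    with refl ← commonInNeighbour-unique no4 u≢v wuv (bu , av) = ax
  ... | no w≢a   | no a≢b   | no b≢w   =
    ⊥-elim (commonInNeighbours-not-distinct no3 no6 u≢v v≢x x≢u wuv avx bxu w≢a a≢b b≢w)

lemma5p2 : (D : Digraph) → GirthAtLeast7 D → (K : Vertex D → Set) → IsCliqueNo D K →
    (∃ λ u → ∃ λ v → K u × K v × u ≢ v) →
    ∃ λ w → ∀ x → K x → Arc D w x
lemma5p2 D girth K clique (u , v , Ku , Kv , u≢v) with clique u v Ku Kv u≢v
... | _ , w , wuv@(wu , wv) = w , inNeighbour
  where
  inNeighbour : ∀ x → K x → Arc D w x
  inNeighbour x Kx with x ≟ u | x ≟ v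
  ... | yes refl | _        = wu
  ... | _        | yes refl = wv
  ... | no x≢u   | no x≢v   =
    commonInNeighbour⇒inNeighbourOfThird
      (girth 3 (from-yes (3 <? 7))) (girth 4 (from-yes (4 <? 7))) (girth 6 (from-yes (6 <? 7)))
      u≢v (≢-sym x≢v) x≢u wuv
      (proj₂ (clique v x Kv Kx (≢-sym x≢v))) (proj₂ (clique x u Kx Ku x≢u))
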